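{- For every integer $n\geq 2$, $$CB_{n+1}(t)=(n+1)B_n(t)+2(n+1)\sum_{i=1}^{n}(t-1)^i B_{n-i}(t),$$ where the polynomials $B_k(t)$ and $CB_k(t)$ are as defined in the context.
   Context: For a permutation $\pi=[\pi_1,\dots,\pi_n]\in S_n$ (one-line notation), a (regular) bond is a pair $(\pi_i,\pi_{i+1})$ with $1\le i\le n-1$ and $\pi_i-\pi_{i+1}=\pm1$; $bnd(\pi)$ denotes the number of regular bonds of $\pi$. With the convention $\pi_{n+1}=\pi_1$, a cyclic bond is a pair $(\pi_i,\pi_{i+1})$ with $1\le i\le n$ and $\pi_i-\pi_{i+1}=\pm1$ (i.e. a regular bond, or the edge bond $(\pi_n,\pi_1)$ when $\pi_n-\pi_1=\pm1$); $cbnd(\pi)$ denotes the number of cyclic bonds of $\pi$. For $n=1$ the permutation $[1]$ has no cyclic bonds, and each of the two permutations of $S_2$ is regarded as having $2$ cyclic bonds. Define $B_0(t)=CB_0(t)=1$ and, for $n\ge1$, $B_n(t)=\sum_{\pi\in S_n}t^{bnd(\pi)}$ and $CB_n(t)=\sum_{\pi\in S_n}t^{cbnd(\pi)}$. Thus $B_1(t)=CB_1(t)=1$, $B_2(t)=2t$, $CB_2(t)=2t^2$, $B_3(t)=2t^2+4t$, $CB_3(t)=6t^2$. -}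

module Defs where

open import Data.Nat as ℕ using (ℕ; zero; suc)
open import Data.Integer as ℤ using (ℤ; +_; -_)
open import Data.List using (List; []; _∷_; map; concatMap; filter; foldr; length; upTo; replicate; _++_; sum)
open import Data.List.Relation.Unary.Unique.Propositional using (Unique)
open import Data.List.Relation.Unary.Unique.Propositional.Properties using ()
open import Data.List.Relation.Unary.Unique.DecPropositional ℕ._≟_ using (unique?)
open import Relation.Nullary using (yes; no)

-- Polynomials in t with integer coefficients, as coefficient lists
-- (index k = coefficient of t^k).  Equality of polynomials is
-- coefficientwise equality (trailing zeros are irrelevant).

Poly : Set
Poly = List ℤ

coeff : Poly → ℕ → ℤ
coeff []       _       = + 0
coeff (a ∷ p)  zero    = a
coeff (a ∷ p)  (suc k) = coeff p k

_⊕_ : Poly → Poly → Poly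
[]      ⊕ q       = q
(a ∷ p) ⊕ []      = a ∷ p
(a ∷ p) ⊕ (b ∷ q) = (a ℤ.+ b) ∷ (p ⊕ q)
infixl 6 _⊕_

_·_ : ℤ → Poly → Poly
c · p = map (c ℤ.*_) p
infixl 7 _·_

_⊗_ : Poly → Poly → Poly
[]      ⊗ q = []
(a ∷ p) ⊗ q = (a · q) ⊕ (+ 0 ∷ (p ⊗ q))
infixl 7 _⊗_

_≈ₚ_ : Poly → Poly → Set
p ≈ₚ q = ∀ k → coeff p k ≡ coeff q k
  where open import Relation.Binary.PropositionalEquality using (_≡_)

𝟙 : Poly
𝟙 = + 1 ∷ []

t-1 : Poly
t-1 = - (+ 1) ∷ + 1 ∷ []

_^ₚ_ : Poly → ℕ → Poly
p ^ₚ zero  = 𝟙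
p ^ₚ suc k = p ⊗ (p ^ₚ k)

tpow : ℕ → Poly
tpow k = replicate k (+ 0) ++ (+ 1 ∷ [])

Σₚ : List Poly → Poly
Σₚ = foldr _⊕_ []

-- Permutations of [n] = {1,…,n} in one-line notation.
-- S n = all length-n words over {1,…,n} without repeated letters.

words : ℕ → ℕ → List (List ℕ)
words n zero    = [] ∷ []
words n (suc m) = concatMap (λ w → map (λ v → suc v ∷ w) (upTo n)) (words n m)

S : ℕ → List (List ℕ)
S n = filter unique? (words n n)

adj : ℕ → ℕ → ℕ
adj a b with a ℕ.≟ suc b | b ℕ.≟ suc a
... | yes _ | _     = 1
... | no _  | yes _ = 1
... | no _  | no _  = 0

bnd : List ℕ → ℕ
bnd []            = 0
bnd (a ∷ [])      = 0
bnd (a ∷ b ∷ w)   = adj a b ℕ.+ bnd (b ∷ w)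

last : ℕ → List ℕ → ℕ
last a []      = a
last a (b ∷ w) = last b w

-- number of cyclic bonds: regular bonds plus the edge pair (π_n, π_1).
-- For n = 1 the edge pair is (1,1), not a bond; for n = 2 this gives
-- 2 for both permutations, matching the stated convention.
cbnd : List ℕ → ℕ
cbnd []       = 0
cbnd (a ∷ w)  = bnd (a ∷ w) ℕ.+ adj (last a w) a

B : ℕ → Poly
B zero    = 𝟙
B (suc n) = Σₚ (map (λ π → tpow (bnd π)) (S (suc n)))

CB : ℕ → Poly
CB zero    = 𝟙
CB (suc n) = Σₚ (map (λ π → tpow (cbnd π)) (S (suc n)))

_⋆_ : ℕ → Poly → Poly
m ⋆ p = (+ m) · p
infixl 7 _⋆_

sumTerm : ℕ → Poly
sumTerm n = Σₚ (map (λ i → (t-1 ^ₚ i) ⊗ B (n ℕ.∸ i)) (map suc (upTo n)))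

{-# OPTIONS --safe #-}
-- Rotating a word preserves its cyclic bonds, and every permutation of [n+1] is, in exactly one
-- way, one of the n+1 rotations of (n+1)σ with σ ∈ S_n; hence CB_{n+1} = (n+1) Σ_σ t^cbnd((n+1)σ).
-- The cyclic bonds of (n+1)σ are those of σ plus one bond for each end of σ that equals n, and
-- for n ≥ 2 at most one end does, so t^cbnd((n+1)σ) = t^bnd(σ) + ([σ₁ = n] + [σₙ = n]) (t-1) t^bnd(σ).
-- Reversal exchanges the two ends, and the polynomial F_n counting the σ with σ₁ = n satisfies
-- F_{n+1} = B_n + (t-1) F_n (strip the leading n+1), so (t-1) F_n = Σ_{i=1}^n (t-1)^i B_{n-i}.
module Submission where

open import Defs
open import Data.Nat as ℕ using (ℕ; zero; suc; _≤_; _<_; _+_; _*_; _∸_; s≤s; z≤n)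
import Data.Nat.Properties as ℕₚ
open import Data.Integer as ℤ using (+_; -_)
import Data.Integer.Properties as ℤₚ
open import Data.List using (List; []; _∷_; map; _++_; _∷ʳ_; concatMap; filter; length; upTo; applyUpTo; applyDownFrom; take; drop; reverse)
import Data.List.Properties as Listₚ
open import Data.List.Membership.Propositional using (_∈_; _∉_; find; lose)
open import Data.List.Membership.Propositional.Properties
open import Data.List.Membership.Propositional.Properties.WithK using (unique∧set⇒bag)
import Data.List.Membership.DecPropositional as DecMembership
open import Data.List.Relation.Binary.Subset.Propositional using (_⊆_)
open import Data.List.Relation.Binary.BagAndSetEquality using (∼bag⇒↭)
open import Data.List.Relation.Binary.Permutation.Propositional using (_↭_; ↭-sym; ↭-trans; ↭-prep; ↭-reflexive; ↭⇒↭ₛ)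
import Data.List.Relation.Binary.Permutation.Propositional.Properties as ↭ₚ
import Data.List.Relation.Binary.Permutation.Setoid.Properties as ↭ₛₚ
open import Data.List.Relation.Unary.Any using (here; there)
open import Data.List.Relation.Unary.All as All using (All; []; _∷_)
open import Data.List.Relation.Unary.AllPairs using ([]; _∷_)
open import Data.List.Relation.Unary.Unique.Propositional using (Unique)
import Data.List.Relation.Unary.Unique.Propositional.Properties as Uniqueₚ
open import Data.List.Relation.Unary.Unique.DecPropositional ℕ._≟_ using (unique?)
open import Data.Product using (_×_; _,_; ∃; proj₁; proj₂)
open import Data.Sum using (_⊎_; inj₁; inj₂)
open import Data.Empty using (⊥)
open import Function using (_∘_; mk⇔)
open import Algebra.Structures using (IsCommutativeMonoid)
import Algebra.Properties.CommutativeSemigroup as CommSemigroupₚ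
open import Relation.Binary.Bundles using (Setoid)
open import Relation.Binary.Structures using (IsEquivalence)
open import Relation.Binary.Definitions using (DecidableEquality)
open import Relation.Binary.PropositionalEquality
import Relation.Binary.Reasoning.Setoid
open import Relation.Nullary using (yes; no; contradiction)

-- Polynomials as coefficient lists

-- _≈ₚ_ wrapped in a record, so that both sides can be inferred from a proof.
infix 4 _≈_
record _≈_ (p q : Poly) : Set where
  constructor coeffwise
  field coeff-≡ : ∀ k → coeff p k ≡ coeff q k
open _≈_

≈-isEquivalence : IsEquivalence _≈_
≈-isEquivalence = record
  { refl  = coeffwise λ _ → refl
  ; sym   = λ p≈q → coeffwise λ k → sym (coeff-≡ p≈q k)
  ; trans = λ p≈q q≈r → coeffwise λ k → trans (coeff-≡ p≈q k) (coeff-≡ q≈r k)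
  }

≈-setoid : Setoid _ _
≈-setoid = record { isEquivalence = ≈-isEquivalence }

module ≈-Reasoning = Relation.Binary.Reasoning.Setoid ≈-setoid

open Setoid ≈-setoid using () renaming (refl to ≈-refl; sym to ≈-sym; trans to ≈-trans; reflexive to ≈-reflexive)

coeff-⊕ : ∀ p q k → coeff (p ⊕ q) k ≡ coeff p k ℤ.+ coeff q k
coeff-⊕ []      q       k       = sym (ℤₚ.+-identityˡ _)
coeff-⊕ (a ∷ p) []      k       = sym (ℤₚ.+-identityʳ _)
coeff-⊕ (a ∷ p) (b ∷ q) zero    = refl
coeff-⊕ (a ∷ p) (b ∷ q) (suc k) = coeff-⊕ p q k

coeff-· : ∀ a p k → coeff (a · p) k ≡ a ℤ.* coeff p k
coeff-· a []      k       = sym (ℤₚ.*-zeroʳ a)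
coeff-· a (b ∷ p) zero    = refl
coeff-· a (b ∷ p) (suc k) = coeff-· a p k

⊕-cong : ∀ {p p′ q q′} → p ≈ p′ → q ≈ q′ → p ⊕ q ≈ p′ ⊕ q′
⊕-cong {p} {p′} {q} {q′} p≈p′ q≈q′ = coeffwise λ k → begin
  coeff (p ⊕ q) k             ≡⟨ coeff-⊕ p q k ⟩
  coeff p k ℤ.+ coeff q k     ≡⟨ cong₂ ℤ._+_ (coeff-≡ p≈p′ k) (coeff-≡ q≈q′ k) ⟩
  coeff p′ k ℤ.+ coeff q′ k   ≡⟨ coeff-⊕ p′ q′ k ⟨
  coeff (p′ ⊕ q′) k           ∎
  where open ≡-Reasoning

⊕-congˡ : ∀ {p q q′} → q ≈ q′ → p ⊕ q ≈ p ⊕ q′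
⊕-congˡ = ⊕-cong ≈-refl

⊕-congʳ : ∀ {p p′ q} → p ≈ p′ → p ⊕ q ≈ p′ ⊕ q
⊕-congʳ p≈p′ = ⊕-cong p≈p′ ≈-refl

·-congˡ : ∀ a {p q} → p ≈ q → a · p ≈ a · q
·-congˡ a {p} {q} p≈q = coeffwise λ k → begin
  coeff (a · p) k     ≡⟨ coeff-· a p k ⟩
  a ℤ.* coeff p k     ≡⟨ cong (a ℤ.*_) (coeff-≡ p≈q k) ⟩
  a ℤ.* coeff q k     ≡⟨ coeff-· a q k ⟨
  coeff (a · q) k     ∎
  where open ≡-Reasoning

∷-congˡ : ∀ a {p q} → p ≈ q → a ∷ p ≈ a ∷ q
∷-congˡ a p≈q = coeffwise λ { zero → refl ; (suc k) → coeff-≡ p≈q k }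


⊕-identityʳ : ∀ p → p ⊕ [] ≡ p
⊕-identityʳ []      = refl
⊕-identityʳ (a ∷ p) = refl

⊕-assoc : ∀ p q r → (p ⊕ q) ⊕ r ≡ p ⊕ (q ⊕ r)
⊕-assoc []      q       r       = refl
⊕-assoc (a ∷ p) []      r       = refl
⊕-assoc (a ∷ p) (b ∷ q) []      = refl
⊕-assoc (a ∷ p) (b ∷ q) (c ∷ r) = cong₂ _∷_ (ℤₚ.+-assoc a b c) (⊕-assoc p q r)

⊕-comm : ∀ p q → p ⊕ q ≡ q ⊕ p
⊕-comm []      q       = sym (⊕-identityʳ q)
⊕-comm (a ∷ p) []      = refl
⊕-comm (a ∷ p) (b ∷ q) = cong₂ _∷_ (ℤₚ.+-comm a b) (⊕-comm p q)

⊕-isCommutativeMonoid : IsCommutativeMonoid _≡_ _⊕_ []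
⊕-isCommutativeMonoid = record
  { isMonoid = record
    { isSemigroup = record
      { isMagma = record { isEquivalence = isEquivalence ; ∙-cong = cong₂ _⊕_ }
      ; assoc   = ⊕-assoc }
    ; identity = (λ _ → refl) , ⊕-identityʳ }
  ; comm = ⊕-comm }

⊕-interchange : ∀ p q r s → (p ⊕ q) ⊕ (r ⊕ s) ≡ (p ⊕ r) ⊕ (q ⊕ s)
⊕-interchange = CommSemigroupₚ.interchange
  (record { isCommutativeSemigroup = IsCommutativeMonoid.isCommutativeSemigroup ⊕-isCommutativeMonoid })

·-distribˡ-⊕ : ∀ a p q → a · (p ⊕ q) ≡ a · p ⊕ a · q
·-distribˡ-⊕ a []      q       = refl
·-distribˡ-⊕ a (b ∷ p) []      = refl
·-distribˡ-⊕ a (b ∷ p) (c ∷ q) = cong₂ _∷_ (ℤₚ.*-distribˡ-+ a b c) (·-distribˡ-⊕ a p q)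

·-distribʳ-+ : ∀ a b p → (a ℤ.+ b) · p ≡ a · p ⊕ b · p
·-distribʳ-+ a b []      = refl
·-distribʳ-+ a b (c ∷ p) = cong₂ _∷_ (ℤₚ.*-distribʳ-+ c a b) (·-distribʳ-+ a b p)

·-assoc : ∀ a b p → a · (b · p) ≡ (a ℤ.* b) · p
·-assoc a b p = trans (sym (Listₚ.map-∘ p)) (Listₚ.map-cong (λ c → sym (ℤₚ.*-assoc a b c)) p)

·-identityˡ : ∀ p → + 1 · p ≡ p
·-identityˡ p = trans (Listₚ.map-cong ℤₚ.*-identityˡ p) (Listₚ.map-id p)

·-zeroˡ : ∀ p → + 0 · p ≈ []
·-zeroˡ p = coeffwise λ k → trans (coeff-· (+ 0) p k) (ℤₚ.*-zeroˡ (coeff p k))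

⊕-inverseʳ : ∀ p → p ⊕ (- + 1) · p ≈ []
⊕-inverseʳ p = coeffwise λ k → begin
  coeff (p ⊕ (- + 1) · p) k              ≡⟨ coeff-⊕ p ((- + 1) · p) k ⟩
  coeff p k ℤ.+ coeff ((- + 1) · p) k    ≡⟨ cong (ℤ._+_ (coeff p k)) (trans (coeff-· (- + 1) p k) (ℤₚ.-1*i≡-i (coeff p k))) ⟩
  coeff p k ℤ.- coeff p k                ≡⟨ ℤₚ.+-inverseʳ (coeff p k) ⟩
  + 0                                    ∎
  where open ≡-Reasoning

[0]≈[] : + 0 ∷ [] ≈ []
[0]≈[] = coeffwise λ { zero → refl ; (suc k) → refl }


Δ : Poly → Poly
Δ p = (- + 1) · p ⊕ (+ 0 ∷ p)

Δ-cong : ∀ {p q} → p ≈ q → Δ p ≈ Δ q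
Δ-cong p≈q = ⊕-cong (·-congˡ (- + 1) p≈q) (∷-congˡ (+ 0) p≈q)

Δ-⊕ : ∀ p q → Δ (p ⊕ q) ≡ Δ p ⊕ Δ q
Δ-⊕ p q = begin
  (- + 1) · (p ⊕ q) ⊕ (+ 0 ∷ p ⊕ q)                        ≡⟨ cong (_⊕ (+ 0 ∷ p ⊕ q)) (·-distribˡ-⊕ (- + 1) p q) ⟩
  ((- + 1) · p ⊕ (- + 1) · q) ⊕ ((+ 0 ∷ p) ⊕ (+ 0 ∷ q))    ≡⟨ ⊕-interchange ((- + 1) · p) ((- + 1) · q) (+ 0 ∷ p) (+ 0 ∷ q) ⟩
  Δ p ⊕ Δ q                                                ∎
  where open ≡-Reasoning

Δ-· : ∀ a p → Δ (a · p) ≡ a · Δ p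
Δ-· a p = begin
  (- + 1) · (a · p) ⊕ (+ 0 ∷ a · p)           ≡⟨ cong₂ (λ x y → x ⊕ (y ∷ a · p)) scalars-commute (sym (ℤₚ.*-zeroʳ a)) ⟩
  a · ((- + 1) · p) ⊕ (a ℤ.* + 0 ∷ a · p)     ≡⟨ ·-distribˡ-⊕ a ((- + 1) · p) (+ 0 ∷ p) ⟨
  a · Δ p                                     ∎
  where
  open ≡-Reasoning
  scalars-commute : (- + 1) · (a · p) ≡ a · ((- + 1) · p)
  scalars-commute = trans (·-assoc (- + 1) a p)
    (trans (cong (_· p) (ℤₚ.*-comm (- + 1) a)) (sym (·-assoc a (- + 1) p)))

Δ-[] : Δ [] ≈ []
Δ-[] = [0]≈[]

⊕-Δ : ∀ p → p ⊕ Δ p ≈ + 0 ∷ p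
⊕-Δ p = begin
  p ⊕ ((- + 1) · p ⊕ (+ 0 ∷ p))   ≡⟨ ⊕-assoc p ((- + 1) · p) (+ 0 ∷ p) ⟨
  (p ⊕ (- + 1) · p) ⊕ (+ 0 ∷ p)   ≈⟨ ⊕-congʳ (⊕-inverseʳ p) ⟩
  + 0 ∷ p                         ∎
  where open ≈-Reasoning

⊗-distribʳ-⊕ : ∀ p q r → (p ⊕ q) ⊗ r ≡ p ⊗ r ⊕ q ⊗ r
⊗-distribʳ-⊕ []      q       r = refl
⊗-distribʳ-⊕ (a ∷ p) []      r = sym (⊕-identityʳ ((a ∷ p) ⊗ r))
⊗-distribʳ-⊕ (a ∷ p) (b ∷ q) r = begin
  (a ℤ.+ b) · r ⊕ (+ 0 ∷ (p ⊕ q) ⊗ r)                  ≡⟨ cong₂ (λ x y → x ⊕ (+ 0 ∷ y)) (·-distribʳ-+ a b r) (⊗-distribʳ-⊕ p q r) ⟩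
  (a · r ⊕ b · r) ⊕ ((+ 0 ∷ p ⊗ r) ⊕ (+ 0 ∷ q ⊗ r))    ≡⟨ ⊕-interchange (a · r) (b · r) (+ 0 ∷ p ⊗ r) (+ 0 ∷ q ⊗ r) ⟩
  (a · r ⊕ (+ 0 ∷ p ⊗ r)) ⊕ (b · r ⊕ (+ 0 ∷ q ⊗ r))    ∎
  where open ≡-Reasoning

·-⊗ : ∀ a p q → (a · p) ⊗ q ≡ a · (p ⊗ q)
·-⊗ a []      q = refl
·-⊗ a (b ∷ p) q = begin
  (a ℤ.* b) · q ⊕ (+ 0 ∷ (a · p) ⊗ q)        ≡⟨ cong₂ (λ x y → x ⊕ (y ∷ (a · p) ⊗ q)) (sym (·-assoc a b q)) (sym (ℤₚ.*-zeroʳ a)) ⟩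
  a · (b · q) ⊕ (a ℤ.* + 0 ∷ (a · p) ⊗ q)    ≡⟨ cong (λ x → a · (b · q) ⊕ (a ℤ.* + 0 ∷ x)) (·-⊗ a p q) ⟩
  a · (b · q) ⊕ a · (+ 0 ∷ p ⊗ q)            ≡⟨ ·-distribˡ-⊕ a (b · q) (+ 0 ∷ p ⊗ q) ⟨
  a · (b · q ⊕ (+ 0 ∷ p ⊗ q))                ∎
  where open ≡-Reasoning

0∷-⊗ : ∀ p q → (+ 0 ∷ p) ⊗ q ≈ + 0 ∷ p ⊗ q
0∷-⊗ p q = ⊕-congʳ (·-zeroˡ q)

𝟙-⊗ : ∀ p → 𝟙 ⊗ p ≈ p
𝟙-⊗ p = begin
  + 1 · p ⊕ (+ 0 ∷ [])   ≈⟨ ⊕-congˡ [0]≈[] ⟩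
  + 1 · p ⊕ []           ≡⟨ ⊕-identityʳ (+ 1 · p) ⟩
  + 1 · p                ≡⟨ ·-identityˡ p ⟩
  p                      ∎
  where open ≈-Reasoning

𝟙⊗-⊗ : ∀ p q → (𝟙 ⊗ p) ⊗ q ≈ p ⊗ q
𝟙⊗-⊗ p q = begin
  (+ 1 · p ⊕ (+ 0 ∷ [])) ⊗ q            ≡⟨ ⊗-distribʳ-⊕ (+ 1 · p) (+ 0 ∷ []) q ⟩
  (+ 1 · p) ⊗ q ⊕ (+ 0 ∷ []) ⊗ q        ≡⟨ cong (λ x → x ⊗ q ⊕ (+ 0 ∷ []) ⊗ q) (·-identityˡ p) ⟩
  p ⊗ q ⊕ (+ 0 ∷ []) ⊗ q                ≈⟨ ⊕-congˡ (≈-trans (0∷-⊗ [] q) [0]≈[]) ⟩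
  p ⊗ q ⊕ []                            ≡⟨ ⊕-identityʳ (p ⊗ q) ⟩
  p ⊗ q                                 ∎
  where open ≈-Reasoning

t-1⊗-⊗ : ∀ p q → (t-1 ⊗ p) ⊗ q ≈ Δ (p ⊗ q)
t-1⊗-⊗ p q = begin
  ((- + 1) · p ⊕ (+ 0 ∷ 𝟙 ⊗ p)) ⊗ q           ≡⟨ ⊗-distribʳ-⊕ ((- + 1) · p) (+ 0 ∷ 𝟙 ⊗ p) q ⟩
  ((- + 1) · p) ⊗ q ⊕ (+ 0 ∷ 𝟙 ⊗ p) ⊗ q       ≡⟨ cong (_⊕ (+ 0 ∷ 𝟙 ⊗ p) ⊗ q) (·-⊗ (- + 1) p q) ⟩
  (- + 1) · (p ⊗ q) ⊕ (+ 0 ∷ 𝟙 ⊗ p) ⊗ q       ≈⟨ ⊕-congˡ (0∷-⊗ (𝟙 ⊗ p) q) ⟩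
  (- + 1) · (p ⊗ q) ⊕ (+ 0 ∷ (𝟙 ⊗ p) ⊗ q)     ≈⟨ ⊕-congˡ (∷-congˡ (+ 0) (𝟙⊗-⊗ p q)) ⟩
  Δ (p ⊗ q)                                   ∎
  where open ≈-Reasoning

⋆-distribʳ-+ : ∀ m n p → (m + n) ⋆ p ≡ m ⋆ p ⊕ n ⋆ p
⋆-distribʳ-+ m n p = trans (cong (_· p) (ℤₚ.pos-+ m n)) (·-distribʳ-+ (+ m) (+ n) p)

⋆-⊕-double : ∀ m p q → m ⋆ (p ⊕ (q ⊕ q)) ≡ m ⋆ p ⊕ (2 * m) ⋆ q
⋆-⊕-double m p q = begin
  m ⋆ (p ⊕ (q ⊕ q))              ≡⟨ ·-distribˡ-⊕ (+ m) p (q ⊕ q) ⟩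
  m ⋆ p ⊕ m ⋆ (q ⊕ q)            ≡⟨ cong (m ⋆ p ⊕_) (·-distribˡ-⊕ (+ m) q q) ⟩
  m ⋆ p ⊕ (m ⋆ q ⊕ m ⋆ q)        ≡⟨ cong (m ⋆ p ⊕_) (⋆-distribʳ-+ m m q) ⟨
  m ⋆ p ⊕ (m + m) ⋆ q            ≡⟨ cong (λ k → m ⋆ p ⊕ k ⋆ q) (cong (_+_ m) (ℕₚ.+-identityʳ m)) ⟨
  m ⋆ p ⊕ (2 * m) ⋆ q            ∎
  where open ≡-Reasoning

⋆-congˡ : ∀ m {p q} → p ≈ q → m ⋆ p ≈ m ⋆ q
⋆-congˡ m = ·-congˡ (+ m)

tpow-suc : ∀ x → tpow (suc x) ≈ tpow x ⊕ Δ (tpow x)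
tpow-suc x = ≈-sym (⊕-Δ (tpow x))

tpow-+≤1 : ∀ e x → e ≤ 1 → tpow (e + x) ≈ tpow x ⊕ e ⋆ Δ (tpow x)
tpow-+≤1 zero    x ℕ.z≤n = begin
  tpow x                       ≡⟨ ⊕-identityʳ (tpow x) ⟨
  tpow x ⊕ []                  ≈⟨ ⊕-congˡ (·-zeroˡ (Δ (tpow x))) ⟨
  tpow x ⊕ 0 ⋆ Δ (tpow x)      ∎
  where open ≈-Reasoning
tpow-+≤1 (suc zero) x (ℕ.s≤s ℕ.z≤n) = begin
  tpow (suc x)                 ≈⟨ tpow-suc x ⟩
  tpow x ⊕ Δ (tpow x)          ≡⟨ cong (tpow x ⊕_) (·-identityˡ (Δ (tpow x))) ⟨
  tpow x ⊕ 1 ⋆ Δ (tpow x)      ∎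
  where open ≈-Reasoning


-- Sums

∑ : {A : Set} → List A → (A → Poly) → Poly
∑ xs f = Σₚ (map f xs)

module _ {A : Set} where

  Σₚ-++ : ∀ ps qs → Σₚ (ps ++ qs) ≡ Σₚ ps ⊕ Σₚ qs
  Σₚ-++ []       qs = refl
  Σₚ-++ (p ∷ ps) qs = trans (cong (p ⊕_) (Σₚ-++ ps qs)) (sym (⊕-assoc p (Σₚ ps) (Σₚ qs)))

  ∑-↭ : ∀ {xs ys : List A} (f : A → Poly) → xs ↭ ys → ∑ xs f ≡ ∑ ys f
  ∑-↭ f xs↭ys = ↭ₛₚ.foldr-commMonoid (setoid Poly) ⊕-isCommutativeMonoid (↭⇒↭ₛ (↭ₚ.map⁺ f xs↭ys))

  ∑-map : ∀ {B : Set} (g : B → A) (f : A → Poly) xs → ∑ (map g xs) f ≡ ∑ xs (f ∘ g)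
  ∑-map g f xs = cong Σₚ (sym (Listₚ.map-∘ xs))

  ∑-concatMap : ∀ {B : Set} (g : A → List B) (f : B → Poly) xs →
                ∑ (concatMap g xs) f ≡ ∑ xs (λ x → ∑ (g x) f)
  ∑-concatMap g f []       = refl
  ∑-concatMap g f (x ∷ xs) = begin
    Σₚ (map f (g x ++ concatMap g xs))          ≡⟨ cong Σₚ (Listₚ.map-++ f (g x) (concatMap g xs)) ⟩
    Σₚ (map f (g x) ++ map f (concatMap g xs))  ≡⟨ Σₚ-++ (map f (g x)) (map f (concatMap g xs)) ⟩
    ∑ (g x) f ⊕ ∑ (concatMap g xs) f            ≡⟨ cong (∑ (g x) f ⊕_) (∑-concatMap g f xs) ⟩
    ∑ (x ∷ xs) (λ x → ∑ (g x) f)                ∎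
    where open ≡-Reasoning

  ∑-cong : ∀ {f g : A → Poly} xs → (∀ {x} → x ∈ xs → f x ≈ g x) → ∑ xs f ≈ ∑ xs g
  ∑-cong []       f≈g = ≈-refl
  ∑-cong (x ∷ xs) f≈g = ⊕-cong (f≈g (here refl)) (∑-cong xs (f≈g ∘ there))

  ∑-cong-≡ : ∀ {f g : A → Poly} xs → (∀ x → f x ≡ g x) → ∑ xs f ≡ ∑ xs g
  ∑-cong-≡ xs f≡g = cong Σₚ (Listₚ.map-cong f≡g xs)

  ∑-⊕ : ∀ (f g : A → Poly) xs → ∑ xs (λ x → f x ⊕ g x) ≡ ∑ xs f ⊕ ∑ xs g
  ∑-⊕ f g []       = refl
  ∑-⊕ f g (x ∷ xs) = trans (cong (f x ⊕ g x ⊕_) (∑-⊕ f g xs))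
                           (⊕-interchange (f x) (g x) (∑ xs f) (∑ xs g))

  ∑-⋆ : ∀ m (f : A → Poly) xs → ∑ xs (λ x → m ⋆ f x) ≡ m ⋆ ∑ xs f
  ∑-⋆ m f []       = refl
  ∑-⋆ m f (x ∷ xs) = trans (cong (m ⋆ f x ⊕_) (∑-⋆ m f xs)) (sym (·-distribˡ-⊕ (+ m) (f x) (∑ xs f)))

  ∑-Δ : ∀ (f : A → Poly) xs → ∑ xs (Δ ∘ f) ≈ Δ (∑ xs f)
  ∑-Δ f []       = ≈-sym Δ-[]
  ∑-Δ f (x ∷ xs) = ≈-trans (⊕-congˡ (∑-Δ f xs)) (≈-reflexive (sym (Δ-⊕ (f x) (∑ xs f))))

  ∑-⋆Δ : ∀ (e : A → ℕ) (f : A → Poly) xs → ∑ xs (λ x → e x ⋆ Δ (f x)) ≈ Δ (∑ xs (λ x → e x ⋆ f x))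
  ∑-⋆Δ e f xs = ≈-trans (≈-reflexive (∑-cong-≡ xs λ x → sym (Δ-· (+ e x) (f x)))) (∑-Δ (λ x → e x ⋆ f x) xs)

  ∑-const : ∀ p (xs : List A) → ∑ xs (λ _ → p) ≈ length xs ⋆ p
  ∑-const p []       = ≈-sym (·-zeroˡ p)
  ∑-const p (x ∷ xs) = begin
    p ⊕ ∑ xs (λ _ → p)       ≈⟨ ⊕-congˡ (∑-const p xs) ⟩
    p ⊕ length xs ⋆ p        ≡⟨ cong (_⊕ length xs ⋆ p) (·-identityˡ p) ⟨
    1 ⋆ p ⊕ length xs ⋆ p    ≡⟨ ⋆-distribʳ-+ 1 (length xs) p ⟨
    suc (length xs) ⋆ p      ∎
    where open ≈-Reasoning

  ∑-indicator : ∀ (e : A → ℕ) (f : A → Poly) → (∀ x → e x ≤ 1) → ∀ xs →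
                ∑ xs (λ x → e x ⋆ f x) ≈ ∑ (filter (λ x → e x ℕ.≟ 1) xs) f
  ∑-indicator e f e≤1 []       = ≈-refl
  ∑-indicator e f e≤1 (x ∷ xs) with e x | e≤1 x
  ... | 0 | _ = begin
    0 ⋆ f x ⊕ ∑ xs (λ x → e x ⋆ f x)   ≈⟨ ⊕-congʳ (·-zeroˡ (f x)) ⟩
    ∑ xs (λ x → e x ⋆ f x)             ≈⟨ ∑-indicator e f e≤1 xs ⟩
    ∑ (filter (λ x → e x ℕ.≟ 1) xs) f  ∎
    where open ≈-Reasoning
  ... | 1 | _ = ⊕-cong (≈-reflexive (·-identityˡ (f x))) (∑-indicator e f e≤1 xs)
  ... | suc (suc _) | ℕ.s≤s ()

-- Duplicate-free lists and rotations

module _ {A : Set} where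

  ⊆-delete : ∀ {x : A} {xs} α β → x ∉ xs → xs ⊆ α ++ x ∷ β → xs ⊆ α ++ β
  ⊆-delete α β x∉xs xs⊆ {z} z∈xs with ∈-++⁻ α (xs⊆ z∈xs)
  ... | inj₁ z∈α         = ∈-++⁺ˡ z∈α
  ... | inj₂ (here refl) = contradiction z∈xs x∉xs
  ... | inj₂ (there z∈β) = ∈-++⁺ʳ α z∈β

  head∉tail : ∀ {x : A} {xs} → Unique (x ∷ xs) → x ∉ xs
  head∉tail (x≢xs ∷ _) x∈xs = All.lookup x≢xs x∈xs refl

  unique-⊆⇒length≤ : ∀ {xs ys : List A} → Unique xs → xs ⊆ ys → length xs ≤ length ys
  unique-⊆⇒length≤ {[]}     _ _ = ℕ.z≤n
  unique-⊆⇒length≤ {x ∷ xs} u@(_ ∷ u′) xs⊆ys with ∈-∃++ (xs⊆ys (here refl))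
  ... | α , β , refl = ℕₚ.≤-trans
    (ℕ.s≤s (unique-⊆⇒length≤ u′ (⊆-delete α β (head∉tail u) (xs⊆ys ∘ there))))
    (ℕₚ.≤-reflexive (sym (Listₚ.length-++-sucʳ α x β)))

  unique-⊆-length≥⇒⊇ : DecidableEquality A → ∀ {xs ys : List A} →
                       Unique xs → xs ⊆ ys → length ys ≤ length xs → ys ⊆ xs
  unique-⊆-length≥⇒⊇ _≟_ {xs} u xs⊆ys ys≤xs {y} y∈ys with y ∈? xs
    where open DecMembership _≟_ using (_∈?_)
  ... | yes y∈xs = y∈xs
  ... | no  y∉xs with ∈-∃++ y∈ys
  ... | α , β , refl = contradiction
    (ℕₚ.≤-trans (ℕₚ.≤-reflexive (sym (Listₚ.length-++-sucʳ α y β)))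
      (ℕₚ.≤-trans ys≤xs (unique-⊆⇒length≤ u (⊆-delete α β y∉xs xs⊆ys))))
    ℕₚ.1+n≰n

  Unique-resp-↭ : ∀ {xs ys : List A} → xs ↭ ys → Unique xs → Unique ys
  Unique-resp-↭ xs↭ys = ↭ₛₚ.Unique-resp-↭ (setoid A) (↭⇒↭ₛ xs↭ys)

  unique-⊆-⊇⇒↭ : ∀ {xs ys : List A} → Unique xs → Unique ys → xs ⊆ ys → ys ⊆ xs → xs ↭ ys
  unique-⊆-⊇⇒↭ ux uy xs⊆ys ys⊆xs = ∼bag⇒↭ (unique∧set⇒bag ux uy (mk⇔ xs⊆ys ys⊆xs))

  module _ {B : Set} where

    map-unique-on : ∀ (f : A → B) {xs} → (∀ {x y} → x ∈ xs → y ∈ xs → f x ≡ f y → x ≡ y) →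
                    Unique xs → Unique (map f xs)
    map-unique-on f {[]}     _   []         = []
    map-unique-on f {x ∷ xs} inj (x≢xs ∷ u) =
      All.tabulate (λ fy∈ fx≡ → let y , y∈xs , fy≡ = ∈-map⁻ f fy∈ in
                      All.lookup x≢xs y∈xs (inj (here refl) (there y∈xs) (trans fx≡ fy≡)))
      ∷ map-unique-on f (λ x∈ y∈ → inj (there x∈) (there y∈)) u

    concatMap-unique : ∀ (f : A → List B) {xs} → Unique xs → (∀ {x} → x ∈ xs → Unique (f x)) →
                       (∀ {x y z} → x ∈ xs → y ∈ xs → z ∈ f x → z ∈ f y → x ≡ y) →
                       Unique (concatMap f xs)
    concatMap-unique f {[]}     _            _     _        = []
    concatMap-unique f {x ∷ xs} (x≢xs ∷ u) uf disjoint =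
      Uniqueₚ.++⁺ (uf (here refl))
        (concatMap-unique f u (uf ∘ there) (λ x∈ y∈ → disjoint (there x∈) (there y∈)))
        λ (z∈fx , z∈rest) → let y , y∈xs , z∈fy = find (∈-concatMap⁻ f {xs = xs} z∈rest) in
          All.lookup x≢xs y∈xs (disjoint (here refl) (there y∈xs) z∈fx z∈fy)



  ++-∷-cancel : ∀ {c : A} {α α′ β β′} → c ∉ α → c ∉ α′ → α ++ c ∷ β ≡ α′ ++ c ∷ β′ → α ≡ α′ × β ≡ β′
  ++-∷-cancel {α = []}    {[]}     _    _     refl = refl , refl
  ++-∷-cancel {α = []}    {x ∷ α′} _    c∉α′  eq   = contradiction (here (Listₚ.∷-injectiveˡ eq)) c∉α′
  ++-∷-cancel {α = x ∷ α} {[]}     c∉α  _     eq   = contradiction (here (sym (Listₚ.∷-injectiveˡ eq))) c∉α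
  ++-∷-cancel {α = x ∷ α} {y ∷ α′} c∉α  c∉α′  eq
    with refl , eq′ ← Listₚ.∷-injective eq
    with refl , refl ← ++-∷-cancel (c∉α ∘ there) (c∉α′ ∘ there) eq′ = refl , refl

  ∉-drop : ∀ {c : A} j σ → c ∉ σ → c ∉ drop j σ
  ∉-drop j σ c∉σ c∈ = c∉σ (subst (_ ∈_) (Listₚ.take++drop≡id j σ) (∈-++⁺ʳ (take j σ) c∈))

  rotation : A → List A → ℕ → List A
  rotation c σ j = drop j σ ++ c ∷ take j σ

  rotation-↭ : ∀ c σ j → rotation c σ j ↭ c ∷ σ
  rotation-↭ c σ j = ↭-trans (↭ₚ.++-comm (drop j σ) (c ∷ take j σ))
                             (↭-prep c (↭-reflexive (Listₚ.take++drop≡id j σ)))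

  rotation-injective : ∀ {c σ σ′} j j′ → c ∉ σ → c ∉ σ′ → rotation c σ j ≡ rotation c σ′ j′ →
                       σ ≡ σ′ × drop j σ ≡ drop j′ σ′
  rotation-injective {c} {σ} {σ′} j j′ c∉σ c∉σ′ eq
    with drop≡ , take≡ ← ++-∷-cancel (∉-drop j σ c∉σ) (∉-drop j′ σ′ c∉σ′) eq = σ≡σ′ , drop≡
    where
    open ≡-Reasoning
    σ≡σ′ : σ ≡ σ′
    σ≡σ′ = begin
      σ                        ≡⟨ Listₚ.take++drop≡id j σ ⟨
      take j σ ++ drop j σ     ≡⟨ cong₂ _++_ take≡ drop≡ ⟩
      take j′ σ′ ++ drop j′ σ′ ≡⟨ Listₚ.take++drop≡id j′ σ′ ⟩
      σ′                       ∎

  rotation-injectiveʳ : ∀ {c σ} j j′ → c ∉ σ → j ≤ length σ → j′ ≤ length σ →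
                        rotation c σ j ≡ rotation c σ j′ → j ≡ j′
  rotation-injectiveʳ {σ = σ} j j′ c∉σ j≤ j′≤ eq = ℕₚ.∸-cancelˡ-≡ j≤ j′≤ (begin
    length σ ∸ j         ≡⟨ Listₚ.length-drop j σ ⟨
    length (drop j σ)    ≡⟨ cong length (proj₂ (rotation-injective j j′ c∉σ c∉σ eq)) ⟩
    length (drop j′ σ)   ≡⟨ Listₚ.length-drop j′ σ ⟩
    length σ ∸ j′        ∎)
    where open ≡-Reasoning

-- Permutations of [n]

-- [n, n-1, …, 1], so that range (suc n) = suc n ∷ range n
range : ℕ → List ℕ
range = applyDownFrom suc

range-unique : ∀ n → Unique (range n)
range-unique n = Uniqueₚ.applyDownFrom⁺₁ suc n (λ j<i _ → ℕₚ.<⇒≢ j<i ∘ sym ∘ ℕₚ.suc-injective)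

∈-range⁺ : ∀ {n i} → i < n → suc i ∈ range n
∈-range⁺ = ∈-applyDownFrom⁺ suc

∈-range⁻ : ∀ {n x} → x ∈ range n → ∃ λ i → i < n × x ≡ suc i
∈-range⁻ = ∈-applyDownFrom⁻ suc

∈-range⇒≤ : ∀ {n x} → x ∈ range n → x ≤ n
∈-range⇒≤ x∈ with ∈-range⁻ x∈
... | _ , i<n , refl = i<n

suc∉range : ∀ n → suc n ∉ range n
suc∉range n sn∈ = ℕₚ.1+n≰n (∈-range⇒≤ sn∈)

∈-words⁺ : ∀ n {w} → All (_∈ range n) w → w ∈ words n (length w)
∈-words⁺ n []              = here refl
∈-words⁺ n {x ∷ w} (x∈ ∷ w∈) with ∈-range⁻ x∈
... | i , i<n , refl =
  ∈-concatMap⁺ (λ u → map (λ v → suc v ∷ u) (upTo n))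
    (lose (∈-words⁺ n w∈) (∈-map⁺ (λ v → suc v ∷ w) (∈-upTo⁺ i<n)))

∈-words⁻ : ∀ n m {w} → w ∈ words n m → length w ≡ m × All (_∈ range n) w
∈-words⁻ n zero    (here refl) = refl , []
∈-words⁻ n (suc m) w∈
  with u , u∈ , w∈′ ← find (∈-concatMap⁻ (λ u → map (λ v → suc v ∷ u) (upTo n)) {xs = words n m} w∈)
  with i , i∈ , refl ← ∈-map⁻ (λ v → suc v ∷ u) w∈′
  with len , all ← ∈-words⁻ n m u∈
  = cong suc len , ∈-range⁺ (∈-upTo⁻ i∈) ∷ all

words-unique : ∀ n m → Unique (words n m)
words-unique n zero    = [] ∷ []
words-unique n (suc m) =
  concatMap-unique (λ u → map (λ v → suc v ∷ u) (upTo n)) (words-unique n m)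
    (λ _ → Uniqueₚ.map⁺ (ℕₚ.suc-injective ∘ Listₚ.∷-injectiveˡ) (Uniqueₚ.upTo⁺ n))
    λ {u} {u′} _ _ z∈ z∈′ → tails-agree (∈-map⁻ (λ v → suc v ∷ u) z∈) (∈-map⁻ (λ v → suc v ∷ u′) z∈′)
  where
  tails-agree : ∀ {u u′ z} → (∃ λ v → v ∈ upTo n × z ≡ suc v ∷ u) → (∃ λ v → v ∈ upTo n × z ≡ suc v ∷ u′) → u ≡ u′
  tails-agree (_ , _ , refl) (_ , _ , refl) = refl


S-unique : ∀ n → Unique (S n)
S-unique n = Uniqueₚ.filter⁺ unique? (words-unique n n)

∈-S⁻ : ∀ n {π} → π ∈ S n → π ↭ range n
∈-S⁻ n {π} π∈ with π∈words , π-unique ← ∈-filter⁻ unique? {xs = words n n} π∈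
                 with len , π⊆range ← ∈-words⁻ n n π∈words
  = unique-⊆-⊇⇒↭ π-unique (range-unique n) (All.lookup π⊆range)
      (unique-⊆-length≥⇒⊇ ℕ._≟_ π-unique (All.lookup π⊆range)
        (ℕₚ.≤-reflexive (trans (Listₚ.length-applyDownFrom suc n) (sym len))))

∈-S⁺ : ∀ {n π} → π ↭ range n → π ∈ S n
∈-S⁺ {n} {π} π↭ = subst (λ m → π ∈ filter unique? (words n m)) len
  (∈-filter⁺ unique? (∈-words⁺ n (All.tabulate (λ x∈ → ↭ₚ.∈-resp-↭ π↭ x∈)))
    (Unique-resp-↭ (↭-sym π↭) (range-unique n)))
  where
  len : length π ≡ n
  len = trans (↭ₚ.↭-length π↭) (Listₚ.length-applyDownFrom suc n)

S-↭ : ∀ n {L} → Unique L → (∀ {π} → π ∈ L → π ↭ range n) → (∀ {π} → π ↭ range n → π ∈ L) → S n ↭ L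
S-↭ n uL L⊆ ⊆L = unique-⊆-⊇⇒↭ (S-unique n) uL (⊆L ∘ ∈-S⁻ n) (∈-S⁺ ∘ L⊆)


-- Bonds

adj-sym : ∀ a b → adj a b ≡ adj b a
adj-sym a b with a ℕ.≟ suc b | b ℕ.≟ suc a
... | yes _ | yes _ = refl
... | yes _ | no  _ = refl
... | no  _ | yes _ = refl
... | no  _ | no  _ = refl

adj≤1 : ∀ a b → adj a b ≤ 1
adj≤1 a b with a ℕ.≟ suc b | b ℕ.≟ suc a
... | yes _ | _     = ℕₚ.≤-refl
... | no  _ | yes _ = ℕₚ.≤-refl
... | no  _ | no  _ = ℕ.z≤n

adj≡1⇒ : ∀ a b → adj a b ≡ 1 → a ≡ suc b ⊎ b ≡ suc a
adj≡1⇒ a b _ with a ℕ.≟ suc b | b ℕ.≟ suc a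
adj≡1⇒ a b _  | yes a≡1+b | _         = inj₁ a≡1+b
adj≡1⇒ a b _  | no  _     | yes b≡1+a = inj₂ b≡1+a
adj≡1⇒ a b () | no  _     | no  _

adj-suc : ∀ b → adj (suc b) b ≡ 1
adj-suc b with suc b ℕ.≟ suc b
... | yes _     = refl
... | no  b≢b   = contradiction refl b≢b

adj-top : ∀ {n x} → x ∈ range n → adj (suc n) x ≡ 1 → x ≡ n
adj-top {n} {x} x∈ adj≡1 with adj≡1⇒ (suc n) x adj≡1
... | inj₁ 1+n≡1+x = sym (ℕₚ.suc-injective 1+n≡1+x)
... | inj₂ refl    = contradiction (∈-range⇒≤ x∈) (ℕₚ.1+n≰n ∘ ℕₚ.≤-trans (ℕₚ.n≤1+n (suc n)))

headBond : ℕ → List ℕ → ℕ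
headBond c []      = 0
headBond c (x ∷ _) = adj c x

lastBond : ℕ → List ℕ → ℕ
lastBond c []      = 0
lastBond c (x ∷ w) = adj (last x w) c

headBond≤1 : ∀ c w → headBond c w ≤ 1
headBond≤1 c []      = ℕ.z≤n
headBond≤1 c (x ∷ w) = adj≤1 c x

bnd-∷ : ∀ c τ → bnd (c ∷ τ) ≡ headBond c τ + bnd τ
bnd-∷ c []      = refl
bnd-∷ c (x ∷ τ) = refl

last-∷ʳ : ∀ x w a → last x (w ∷ʳ a) ≡ a
last-∷ʳ x []      a = refl
last-∷ʳ x (y ∷ w) a = last-∷ʳ y w a

lastBond-∷ʳ : ∀ c w a → lastBond c (w ∷ʳ a) ≡ adj a c
lastBond-∷ʳ c []      a = refl
lastBond-∷ʳ c (x ∷ w) a = cong (λ y → adj y c) (last-∷ʳ x w a)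

bnd-∷ʳ : ∀ w a → bnd (w ∷ʳ a) ≡ bnd w + lastBond a w
bnd-∷ʳ []          a = refl
bnd-∷ʳ (x ∷ [])    a = ℕₚ.+-identityʳ (adj x a)
bnd-∷ʳ (x ∷ y ∷ w) a = trans (cong (_+_ (adj x y)) (bnd-∷ʳ (y ∷ w) a))
                             (sym (ℕₚ.+-assoc (adj x y) (bnd (y ∷ w)) (lastBond a (y ∷ w))))

lastBond-reverse : ∀ c w → lastBond c (reverse w) ≡ headBond c w
lastBond-reverse c []      = refl
lastBond-reverse c (a ∷ w) = begin
  lastBond c (reverse (a ∷ w))   ≡⟨ cong (lastBond c) (Listₚ.unfold-reverse a w) ⟩
  lastBond c (reverse w ∷ʳ a)    ≡⟨ lastBond-∷ʳ c (reverse w) a ⟩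
  adj a c                        ≡⟨ adj-sym a c ⟩
  adj c a                        ∎
  where open ≡-Reasoning

bnd-reverse : ∀ w → bnd (reverse w) ≡ bnd w
bnd-reverse []      = refl
bnd-reverse (a ∷ w) = begin
  bnd (reverse (a ∷ w))                       ≡⟨ cong bnd (Listₚ.unfold-reverse a w) ⟩
  bnd (reverse w ∷ʳ a)                        ≡⟨ bnd-∷ʳ (reverse w) a ⟩
  bnd (reverse w) + lastBond a (reverse w)    ≡⟨ cong₂ _+_ (bnd-reverse w) (lastBond-reverse a w) ⟩
  bnd w + headBond a w                        ≡⟨ ℕₚ.+-comm (bnd w) (headBond a w) ⟩
  headBond a w + bnd w                        ≡⟨ bnd-∷ a w ⟨
  bnd (a ∷ w)                                 ∎
  where open ≡-Reasoning

cbnd-rotate : ∀ a w → cbnd (a ∷ w) ≡ cbnd (w ∷ʳ a)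
cbnd-rotate a []      = refl
cbnd-rotate a (b ∷ w) = begin
  (adj a b + bnd (b ∷ w)) + lastBond a (b ∷ w)   ≡⟨ ℕₚ.+-assoc (adj a b) (bnd (b ∷ w)) (lastBond a (b ∷ w)) ⟩
  adj a b + (bnd (b ∷ w) + lastBond a (b ∷ w))   ≡⟨ cong (_+_ (adj a b)) (bnd-∷ʳ (b ∷ w) a) ⟨
  adj a b + bnd ((b ∷ w) ∷ʳ a)                   ≡⟨ ℕₚ.+-comm (adj a b) (bnd ((b ∷ w) ∷ʳ a)) ⟩
  bnd ((b ∷ w) ∷ʳ a) + adj a b                   ≡⟨ cong (λ x → bnd ((b ∷ w) ∷ʳ a) + adj x b) (last-∷ʳ b w a) ⟨
  cbnd ((b ∷ w) ∷ʳ a)                            ∎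
  where open ≡-Reasoning

cbnd-++-comm : ∀ xs ys → cbnd (xs ++ ys) ≡ cbnd (ys ++ xs)
cbnd-++-comm []       ys = cong cbnd (sym (Listₚ.++-identityʳ ys))
cbnd-++-comm (x ∷ xs) ys = begin
  cbnd (x ∷ xs ++ ys)          ≡⟨ cbnd-rotate x (xs ++ ys) ⟩
  cbnd ((xs ++ ys) ∷ʳ x)       ≡⟨ cong cbnd (Listₚ.++-assoc xs ys (x ∷ [])) ⟩
  cbnd (xs ++ (ys ∷ʳ x))       ≡⟨ cbnd-++-comm xs (ys ∷ʳ x) ⟩
  cbnd ((ys ∷ʳ x) ++ xs)       ≡⟨ cong cbnd (Listₚ.++-assoc ys (x ∷ []) xs) ⟩
  cbnd (ys ++ x ∷ xs)          ∎
  where open ≡-Reasoning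


cbnd-rotation : ∀ c σ j → cbnd (rotation c σ j) ≡ cbnd (c ∷ σ)
cbnd-rotation c σ j = trans (cbnd-++-comm (drop j σ) (c ∷ take j σ))
                            (cong (cbnd ∘ (c ∷_)) (Listₚ.take++drop≡id j σ))

-- Rotations of permutations

length-S : ∀ n {σ} → σ ∈ S n → length σ ≡ n
length-S n σ∈ = trans (↭ₚ.↭-length (∈-S⁻ n σ∈)) (Listₚ.length-applyDownFrom suc n)

top∉S : ∀ n {σ} → σ ∈ S n → suc n ∉ σ
top∉S n σ∈ = suc∉range n ∘ ↭ₚ.∈-resp-↭ (∈-S⁻ n σ∈)

rotations : ℕ → List ℕ → List (List ℕ)
rotations n σ = map (rotation (suc n) σ) (upTo (suc n))

rotations-unique : ∀ n → Unique (concatMap (rotations n) (S n))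
rotations-unique n = concatMap-unique (rotations n) (S-unique n) rotations-σ-unique disjoint
  where
  rotations-σ-unique : ∀ {σ} → σ ∈ S n → Unique (rotations n σ)
  rotations-σ-unique {σ} σ∈ = map-unique-on (rotation (suc n) σ)
    (λ j∈ j′∈ → rotation-injectiveʳ _ _ (top∉S n σ∈) (≤-length j∈) (≤-length j′∈))
    (Uniqueₚ.upTo⁺ (suc n))
    where
    ≤-length : ∀ {j} → j ∈ upTo (suc n) → j ≤ length σ
    ≤-length {j} j∈ = subst (j ≤_) (sym (length-S n σ∈)) (ℕₚ.≤-pred (∈-upTo⁻ j∈))

  disjoint : ∀ {σ σ′ π} → σ ∈ S n → σ′ ∈ S n → π ∈ rotations n σ → π ∈ rotations n σ′ → σ ≡ σ′
  disjoint {σ} {σ′} σ∈ σ′∈ π∈ π∈′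
    with j  , _ , refl ← ∈-map⁻ (rotation (suc n) σ)  {xs = upTo (suc n)} π∈
    with j′ , _ , eq   ← ∈-map⁻ (rotation (suc n) σ′) {xs = upTo (suc n)} π∈′
    = proj₁ (rotation-injective j j′ (top∉S n σ∈) (top∉S n σ′∈) eq)

∈-rotations⁻ : ∀ n {π} → π ∈ concatMap (rotations n) (S n) → π ↭ range (suc n)
∈-rotations⁻ n π∈
  with σ , σ∈ , π∈′ ← find (∈-concatMap⁻ (rotations n) {xs = S n} π∈)
  with j , _ , refl ← ∈-map⁻ (rotation (suc n) σ) {xs = upTo (suc n)} π∈′
  = ↭-trans (rotation-↭ (suc n) σ j) (↭-prep (suc n) (∈-S⁻ n σ∈))

∈-rotations⁺ : ∀ n {π} → π ↭ range (suc n) → π ∈ concatMap (rotations n) (S n)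
∈-rotations⁺ n {π} π↭ with ∈-∃++ (↭ₚ.∈-resp-↭ (↭-sym π↭) (here refl))
... | α , β , refl = subst (_∈ concatMap (rotations n) (S n)) rotation≡
  (∈-concatMap⁺ (rotations n) (lose (∈-S⁺ σ↭) (∈-map⁺ (rotation (suc n) (β ++ α)) (∈-upTo⁺ j<))))
  where
  σ↭ : β ++ α ↭ range n
  σ↭ = ↭ₚ.drop-∷ (↭-trans (↭-prep (suc n) (↭ₚ.++-comm β α)) (↭-trans (↭-sym (↭ₚ.shift (suc n) α β)) π↭))

  drop-length : ∀ (β α : List ℕ) → drop (length β) (β ++ α) ≡ α
  drop-length []      α = refl
  drop-length (_ ∷ β) α = drop-length β α

  take-length : ∀ (β α : List ℕ) → take (length β) (β ++ α) ≡ β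
  take-length []      α = refl
  take-length (b ∷ β) α = cong (b ∷_) (take-length β α)

  rotation≡ : rotation (suc n) (β ++ α) (length β) ≡ α ++ suc n ∷ β
  rotation≡ = cong₂ (λ x y → x ++ suc n ∷ y) (drop-length β α) (take-length β α)

  j< : length β < suc n
  j< = ℕ.s≤s (ℕₚ.≤-trans (Listₚ.length-++-≤ˡ β) (ℕₚ.≤-reflexive (length-S n (∈-S⁺ σ↭))))

S-suc↭rotations : ∀ n → S (suc n) ↭ concatMap (rotations n) (S n)
S-suc↭rotations n = S-↭ (suc n) (rotations-unique n) (∈-rotations⁻ n) (∈-rotations⁺ n)


-- Generating polynomials

B≡∑S : ∀ n → B n ≡ ∑ (S n) (tpow ∘ bnd)
B≡∑S zero    = refl
B≡∑S (suc n) = refl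

adj-self : ∀ a → adj a a ≡ 0
adj-self a with a ℕ.≟ suc a
... | yes a≡1+a = contradiction (sym a≡1+a) ℕₚ.1+n≢n
... | no  _     = refl

cbnd-∷ : ∀ c σ → cbnd (c ∷ σ) ≡ (headBond c σ + lastBond c σ) + bnd σ
cbnd-∷ c []      = adj-self c
cbnd-∷ c (a ∷ w) = begin
  (adj c a + bnd (a ∷ w)) + adj (last a w) c   ≡⟨ ℕₚ.+-assoc (adj c a) (bnd (a ∷ w)) (adj (last a w) c) ⟩
  adj c a + (bnd (a ∷ w) + adj (last a w) c)   ≡⟨ cong (_+_ (adj c a)) (ℕₚ.+-comm (bnd (a ∷ w)) (adj (last a w) c)) ⟩
  adj c a + (adj (last a w) c + bnd (a ∷ w))   ≡⟨ ℕₚ.+-assoc (adj c a) (adj (last a w) c) (bnd (a ∷ w)) ⟨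
  (adj c a + adj (last a w) c) + bnd (a ∷ w)   ∎
  where open ≡-Reasoning

last∈ : ∀ b w → last b w ∈ b ∷ w
last∈ b []      = here refl
last∈ b (c ∷ w) = there (last∈ c w)

-- both bonds would make σ begin and end with n
headBond+lastBond≤1 : ∀ {n σ} → 2 ≤ n → σ ∈ S n → headBond (suc n) σ + lastBond (suc n) σ ≤ 1
headBond+lastBond≤1 {n} {[]}    2≤n σ∈ = contradiction (subst (2 ≤_) (sym (length-S n σ∈)) 2≤n) λ ()
headBond+lastBond≤1 {n} {_ ∷ []} 2≤n σ∈ = contradiction (subst (2 ≤_) (sym (length-S n σ∈)) 2≤n) λ { (s≤s ()) }
headBond+lastBond≤1 {n} {a ∷ b ∷ w} 2≤n σ∈ = +≤1 (adj≤1 (suc n) a) (adj≤1 (last b w) (suc n)) not-both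
  where
  σ↭ : a ∷ b ∷ w ↭ range n
  σ↭ = ∈-S⁻ n σ∈
  not-both : adj (suc n) a ≡ 1 → adj (last b w) (suc n) ≡ 1 → ⊥
  not-both first-adj last-adj = head∉tail (Unique-resp-↭ (↭-sym σ↭) (range-unique n)) a∈bw
    where
    in-range : ∀ {x} → x ∈ a ∷ b ∷ w → x ∈ range n
    in-range = ↭ₚ.∈-resp-↭ σ↭
    a∈bw : a ∈ b ∷ w
    a∈bw = subst (_∈ b ∷ w)
      (trans (adj-top (in-range (there (last∈ b w))) (trans (adj-sym (suc n) (last b w)) last-adj))
             (sym (adj-top (in-range (here refl)) first-adj)))
      (last∈ b w)
  +≤1 : ∀ {h l} → h ≤ 1 → l ≤ 1 → (h ≡ 1 → l ≡ 1 → ⊥) → h + l ≤ 1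
  +≤1 z≤n       l≤1       _          = l≤1
  +≤1 (s≤s z≤n) z≤n       _          = s≤s z≤n
  +≤1 (s≤s z≤n) (s≤s z≤n) ¬both      = contradiction refl (¬both refl)

-- F_n: the weight headBond (suc n) σ is [σ₁ = n], by adj-top
Bhead : ℕ → Poly
Bhead n = ∑ (S n) (λ σ → headBond (suc n) σ ⋆ tpow (bnd σ))

Blast : ℕ → Poly
Blast n = ∑ (S n) (λ σ → lastBond (suc n) σ ⋆ tpow (bnd σ))

CB-suc≈rotations : ∀ n → CB (suc n) ≈ suc n ⋆ ∑ (S n) (λ σ → tpow (cbnd (suc n ∷ σ)))
CB-suc≈rotations n = begin
  ∑ (S (suc n)) (tpow ∘ cbnd)                                        ≡⟨ ∑-↭ (tpow ∘ cbnd) (S-suc↭rotations n) ⟩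
  ∑ (concatMap (rotations n) (S n)) (tpow ∘ cbnd)                    ≡⟨ ∑-concatMap (rotations n) (tpow ∘ cbnd) (S n) ⟩
  ∑ (S n) (λ σ → ∑ (rotations n σ) (tpow ∘ cbnd))                    ≡⟨ ∑-cong-≡ (S n) (λ σ → ∑-map _ (tpow ∘ cbnd) (upTo (suc n))) ⟩
  ∑ (S n) (λ σ → ∑ (upTo (suc n)) (tpow ∘ cbnd ∘ rotation (suc n) σ)) ≡⟨ ∑-cong-≡ (S n) (λ σ → ∑-cong-≡ (upTo (suc n)) (cong tpow ∘ cbnd-rotation (suc n) σ)) ⟩
  ∑ (S n) (λ σ → ∑ (upTo (suc n)) (λ _ → tpow (cbnd (suc n ∷ σ))))   ≈⟨ ∑-cong (S n) (λ {σ} _ → ∑-const (tpow (cbnd (suc n ∷ σ))) (upTo (suc n))) ⟩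
  ∑ (S n) (λ σ → length (upTo (suc n)) ⋆ tpow (cbnd (suc n ∷ σ)))    ≡⟨ cong (λ m → ∑ (S n) (λ σ → m ⋆ tpow (cbnd (suc n ∷ σ)))) (Listₚ.length-upTo (suc n)) ⟩
  ∑ (S n) (λ σ → suc n ⋆ tpow (cbnd (suc n ∷ σ)))                    ≡⟨ ∑-⋆ (suc n) (λ σ → tpow (cbnd (suc n ∷ σ))) (S n) ⟩
  suc n ⋆ ∑ (S n) (λ σ → tpow (cbnd (suc n ∷ σ)))                    ∎
  where open ≈-Reasoning

∑-cbnd-top : ∀ {n} → 2 ≤ n → ∑ (S n) (λ σ → tpow (cbnd (suc n ∷ σ))) ≈ B n ⊕ (Δ (Bhead n) ⊕ Δ (Blast n))
∑-cbnd-top {n} 2≤n = begin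
  ∑ (S n) (λ σ → tpow (cbnd (suc n ∷ σ)))                   ≈⟨ ∑-cong (S n) (λ σ∈ → tpow-cbnd σ∈) ⟩
  ∑ (S n) (λ σ → tpow (bnd σ) ⊕ (h σ ⋆ Δ (tpow (bnd σ)) ⊕ l σ ⋆ Δ (tpow (bnd σ))))
      ≡⟨ ∑-⊕ (tpow ∘ bnd) _ (S n) ⟩
  ∑ (S n) (tpow ∘ bnd) ⊕ ∑ (S n) (λ σ → h σ ⋆ Δ (tpow (bnd σ)) ⊕ l σ ⋆ Δ (tpow (bnd σ)))
      ≡⟨ cong₂ _⊕_ (sym (B≡∑S n)) (∑-⊕ (λ σ → h σ ⋆ Δ (tpow (bnd σ))) (λ σ → l σ ⋆ Δ (tpow (bnd σ))) (S n)) ⟩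
  B n ⊕ (∑ (S n) (λ σ → h σ ⋆ Δ (tpow (bnd σ))) ⊕ ∑ (S n) (λ σ → l σ ⋆ Δ (tpow (bnd σ))))
      ≈⟨ ⊕-congˡ {B n} (⊕-cong (∑-⋆Δ h (tpow ∘ bnd) (S n)) (∑-⋆Δ l (tpow ∘ bnd) (S n))) ⟩
  B n ⊕ (Δ (Bhead n) ⊕ Δ (Blast n))                         ∎
  where
  open ≈-Reasoning
  h l : List ℕ → ℕ
  h = headBond (suc n)
  l = lastBond (suc n)
  tpow-cbnd : ∀ {σ} → σ ∈ S n → tpow (cbnd (suc n ∷ σ)) ≈ tpow (bnd σ) ⊕ (h σ ⋆ Δ (tpow (bnd σ)) ⊕ l σ ⋆ Δ (tpow (bnd σ)))
  tpow-cbnd {σ} σ∈ = begin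
    tpow (cbnd (suc n ∷ σ))                                 ≡⟨ cong tpow (cbnd-∷ (suc n) σ) ⟩
    tpow ((h σ + l σ) + bnd σ)                              ≈⟨ tpow-+≤1 (h σ + l σ) (bnd σ) (headBond+lastBond≤1 2≤n σ∈) ⟩
    tpow (bnd σ) ⊕ (h σ + l σ) ⋆ Δ (tpow (bnd σ))           ≡⟨ cong (tpow (bnd σ) ⊕_) (⋆-distribʳ-+ (h σ) (l σ) (Δ (tpow (bnd σ)))) ⟩
    tpow (bnd σ) ⊕ (h σ ⋆ Δ (tpow (bnd σ)) ⊕ l σ ⋆ Δ (tpow (bnd σ))) ∎

starts-with-top↭ : ∀ n → filter (λ π → headBond (suc (suc n)) π ℕ.≟ 1) (S (suc n)) ↭ map (suc n ∷_) (S n)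
starts-with-top↭ n = unique-⊆-⊇⇒↭
  (Uniqueₚ.filter⁺ _ (S-unique (suc n))) (Uniqueₚ.map⁺ Listₚ.∷-injectiveʳ (S-unique n)) starts⇒cons cons⇒starts
  where
  P? = λ π → headBond (suc (suc n)) π ℕ.≟ 1
  starts⇒cons : ∀ {π} → π ∈ filter P? (S (suc n)) → π ∈ map (suc n ∷_) (S n)
  starts⇒cons π∈ with ∈-filter⁻ P? {xs = S (suc n)} π∈
  starts⇒cons {x ∷ τ} _ | π∈S , adj≡1 with refl ← adj-top (↭ₚ.∈-resp-↭ (∈-S⁻ (suc n) π∈S) (here refl)) adj≡1
    = ∈-map⁺ (suc n ∷_) (∈-S⁺ (↭ₚ.drop-∷ (∈-S⁻ (suc n) π∈S)))
  cons⇒starts : ∀ {π} → π ∈ map (suc n ∷_) (S n) → π ∈ filter P? (S (suc n))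
  cons⇒starts π∈ with τ , τ∈ , refl ← ∈-map⁻ (suc n ∷_) {xs = S n} π∈
    = ∈-filter⁺ P? (∈-S⁺ (↭-prep (suc n) (∈-S⁻ n τ∈))) (adj-suc (suc n))

Bhead-suc : ∀ n → Bhead (suc n) ≈ B n ⊕ Δ (Bhead n)
Bhead-suc n = begin
  Bhead (suc n)                                                   ≈⟨ ∑-indicator (headBond (suc (suc n))) (tpow ∘ bnd) (headBond≤1 _) (S (suc n)) ⟩
  ∑ (filter (λ π → headBond (suc (suc n)) π ℕ.≟ 1) (S (suc n))) (tpow ∘ bnd)
                                                                  ≡⟨ ∑-↭ (tpow ∘ bnd) (starts-with-top↭ n) ⟩
  ∑ (map (suc n ∷_) (S n)) (tpow ∘ bnd)                           ≡⟨ ∑-map (suc n ∷_) (tpow ∘ bnd) (S n) ⟩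
  ∑ (S n) (λ τ → tpow (bnd (suc n ∷ τ)))                          ≈⟨ ∑-cong (S n) (λ {τ} _ → tpow-bnd-∷ τ) ⟩
  ∑ (S n) (λ τ → tpow (bnd τ) ⊕ h τ ⋆ Δ (tpow (bnd τ)))           ≡⟨ ∑-⊕ (tpow ∘ bnd) (λ τ → h τ ⋆ Δ (tpow (bnd τ))) (S n) ⟩
  ∑ (S n) (tpow ∘ bnd) ⊕ ∑ (S n) (λ τ → h τ ⋆ Δ (tpow (bnd τ)))   ≈⟨ ⊕-cong (≈-reflexive (sym (B≡∑S n))) (∑-⋆Δ h (tpow ∘ bnd) (S n)) ⟩
  B n ⊕ Δ (Bhead n)                                               ∎
  where
  open ≈-Reasoning
  h : List ℕ → ℕ
  h = headBond (suc n)
  tpow-bnd-∷ : ∀ τ → tpow (bnd (suc n ∷ τ)) ≈ tpow (bnd τ) ⊕ h τ ⋆ Δ (tpow (bnd τ))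
  tpow-bnd-∷ τ = ≈-trans (≈-reflexive (cong tpow (bnd-∷ (suc n) τ))) (tpow-+≤1 (h τ) (bnd τ) (headBond≤1 (suc n) τ))

S↭map-reverse : ∀ n → S n ↭ map reverse (S n)
S↭map-reverse n = S-↭ n (Uniqueₚ.map⁺ Listₚ.reverse-injective (S-unique n)) reversed-perm perm-reversed
  where
  reversed-perm : ∀ {π} → π ∈ map reverse (S n) → π ↭ range n
  reversed-perm π∈ with σ , σ∈ , refl ← ∈-map⁻ reverse {xs = S n} π∈ = ↭-trans (↭ₚ.↭-reverse σ) (∈-S⁻ n σ∈)
  perm-reversed : ∀ {π} → π ↭ range n → π ∈ map reverse (S n)
  perm-reversed {π} π↭ = subst (_∈ map reverse (S n)) (Listₚ.reverse-involutive π)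
    (∈-map⁺ reverse (∈-S⁺ (↭-trans (↭ₚ.↭-reverse π) π↭)))

Blast≡Bhead : ∀ n → Blast n ≡ Bhead n
Blast≡Bhead n = begin
  ∑ (S n) f                                                        ≡⟨ ∑-↭ f (S↭map-reverse n) ⟩
  ∑ (map reverse (S n)) f                                          ≡⟨ ∑-map reverse f (S n) ⟩
  ∑ (S n) (f ∘ reverse)                                            ≡⟨ ∑-cong-≡ (S n) (λ σ → cong₂ (λ e b → e ⋆ tpow b)
                                                                        (lastBond-reverse (suc n) σ) (bnd-reverse σ)) ⟩
  Bhead n                                                          ∎
  where
  open ≡-Reasoning
  f : List ℕ → Poly
  f σ = lastBond (suc n) σ ⋆ tpow (bnd σ)

sumTerm-suc : ∀ n → sumTerm (suc n) ≈ Δ (B n) ⊕ Δ (sumTerm n)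
sumTerm-suc n = begin
  sumTerm (suc n)                                          ≡⟨ ∑-map suc (g (suc n)) (upTo (suc n)) ⟩
  g (suc n) 1 ⊕ ∑ (applyUpTo suc n) (g (suc n) ∘ suc)      ≡⟨ cong (λ is → g (suc n) 1 ⊕ ∑ is (g (suc n) ∘ suc)) (Listₚ.map-upTo suc n) ⟨
  g (suc n) 1 ⊕ ∑ (map suc (upTo n)) (g (suc n) ∘ suc)     ≡⟨ cong (g (suc n) 1 ⊕_) (∑-map suc (g (suc n) ∘ suc) (upTo n)) ⟩
  g (suc n) 1 ⊕ ∑ (upTo n) (g (suc n) ∘ suc ∘ suc)         ≈⟨ ⊕-cong first-term (∑-cong (upTo n) (λ {i} _ → t-1⊗-⊗ (t-1 ^ₚ suc i) (B (n ∸ suc i)))) ⟩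
  Δ (B n) ⊕ ∑ (upTo n) (Δ ∘ g n ∘ suc)                     ≈⟨ ⊕-congˡ {Δ (B n)} (∑-Δ (g n ∘ suc) (upTo n)) ⟩
  Δ (B n) ⊕ Δ (∑ (upTo n) (g n ∘ suc))                     ≡⟨ cong (λ p → Δ (B n) ⊕ Δ p) (∑-map suc (g n) (upTo n)) ⟨
  Δ (B n) ⊕ Δ (sumTerm n)                                  ∎
  where
  open ≈-Reasoning
  g : ℕ → ℕ → Poly
  g n i = (t-1 ^ₚ i) ⊗ B (n ∸ i)
  first-term : g (suc n) 1 ≈ Δ (B n)
  first-term = ≈-trans (t-1⊗-⊗ 𝟙 (B n)) (Δ-cong (𝟙-⊗ (B n)))

Δ-Bhead≈sumTerm : ∀ n → Δ (Bhead n) ≈ sumTerm n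
Δ-Bhead≈sumTerm zero    = coeffwise λ { zero → refl ; (suc zero) → refl ; (suc (suc k)) → refl }
Δ-Bhead≈sumTerm (suc n) = begin
  Δ (Bhead (suc n))                 ≈⟨ Δ-cong (Bhead-suc n) ⟩
  Δ (B n ⊕ Δ (Bhead n))             ≡⟨ Δ-⊕ (B n) (Δ (Bhead n)) ⟩
  Δ (B n) ⊕ Δ (Δ (Bhead n))         ≈⟨ ⊕-congˡ {Δ (B n)} (Δ-cong (Δ-Bhead≈sumTerm n)) ⟩
  Δ (B n) ⊕ Δ (sumTerm n)           ≈⟨ sumTerm-suc n ⟨
  sumTerm (suc n)                   ∎
  where open ≈-Reasoning

theorem2p1 : ∀ (n : ℕ) → 2 ≤ n →
    CB (suc n) ≈ₚ ((suc n ⋆ B n) ⊕ ((2 * suc n) ⋆ sumTerm n))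
theorem2p1 n 2≤n = coeff-≡ (begin
  CB (suc n)                                           ≈⟨ CB-suc≈rotations n ⟩
  suc n ⋆ ∑ (S n) (λ σ → tpow (cbnd (suc n ∷ σ)))      ≈⟨ ⋆-congˡ (suc n) (∑-cbnd-top 2≤n) ⟩
  suc n ⋆ (B n ⊕ (Δ (Bhead n) ⊕ Δ (Blast n)))          ≡⟨ cong (λ p → suc n ⋆ (B n ⊕ (Δ (Bhead n) ⊕ Δ p))) (Blast≡Bhead n) ⟩
  suc n ⋆ (B n ⊕ (Δ (Bhead n) ⊕ Δ (Bhead n)))          ≈⟨ ⋆-congˡ (suc n) (⊕-congˡ {B n} (⊕-cong (Δ-Bhead≈sumTerm n) (Δ-Bhead≈sumTerm n))) ⟩
  suc n ⋆ (B n ⊕ (sumTerm n ⊕ sumTerm n))              ≡⟨ ⋆-⊕-double (suc n) (B n) (sumTerm n) ⟩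
  (suc n ⋆ B n) ⊕ ((2 * suc n) ⋆ sumTerm n)            ∎)
  where open ≈-Reasoning
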